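{- Let $M,N$ be terms of $\lambda^{Sym}_{Prop}$ with $\Gamma,x:A\vdash M:C$ and $\Gamma\vdash N:A$. If $M$ and $N$ are strongly normalizing with respect to $\to_{\beta\pi}$, then so is $M[x:=N]$.
   Context: The calculus $\lambda^{Sym}_{Prop}$: m-types $A::=\alpha\mid\alpha^\bot\mid A\wedge A\mid A\vee A$ over atomic types $\alpha$ and negated atomic types $\alpha^\bot$; types $C::=A\mid\bot$; negation of m-types $(\alpha)^\bot=\alpha^\bot$, $(\alpha^\bot)^\bot=\alpha$, $(A\wedge B)^\bot=A^\bot\vee B^\bot$, $(A\vee B)^\bot=A^\bot\wedge B^\bot$. Typing (contexts assign m-types to variables): $\Gamma,x:A\vdash x:A$; $\langle P_1,P_2\rangle:A_1\wedge A_2$ from $P_1:A_1$, $P_2:A_2$; $\sigma_i(P_i):A_1\vee A_2$ from $P_i:A_i$; $\lambda xP:A^\bot$ from $\Gamma,x:A\vdash P:\bot$; $(P_1\star P_2):\bot$ from $P_1:A^\bot$, $P_2:A$. $\to_{\beta\pi}$ is the compatible closure of $(\lambda xP\star Q)\to P[x:=Q]$, $(Q\star\lambda xP)\to P[x:=Q]$, $(\langle P_1,P_2\rangle\star\sigma_i(Q))\to(P_i\star Q)$, $(\sigma_i(Q)\star\langle P_1,P_2\rangle)\to(Q\star P_i)$. -}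

module Defs where

open import Data.Nat using (ℕ; zero; suc)
open import Data.List using (List; []; _∷_)

data MType : Set where
  atom    : ℕ → MType
  natom   : ℕ → MType
  _∧_     : MType → MType → MType
  _∨_     : MType → MType → MType

_ᗮ : MType → MType
atom a ᗮ  = natom a
natom a ᗮ = atom a
(A ∧ B) ᗮ = (A ᗮ) ∨ (B ᗮ)
(A ∨ B) ᗮ = (A ᗮ) ∧ (B ᗮ)

data Ty : Set where
  m   : MType → Ty
  bot : Ty

data Term : Set where
  var  : ℕ → Term
  ⟨_,_⟩ : Term → Term → Term
  σ₁   : Term → Term
  σ₂   : Term → Term
  lam  : Term → Term
  _⋆_  : Term → Term → Term

ext : (ℕ → ℕ) → ℕ → ℕ
ext ρ zero    = zero
ext ρ (suc n) = suc (ρ n)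

rename : (ℕ → ℕ) → Term → Term
rename ρ (var n)     = var (ρ n)
rename ρ ⟨ P , Q ⟩   = ⟨ rename ρ P , rename ρ Q ⟩
rename ρ (σ₁ P)      = σ₁ (rename ρ P)
rename ρ (σ₂ P)      = σ₂ (rename ρ P)
rename ρ (lam P)     = lam (rename (ext ρ) P)
rename ρ (P ⋆ Q)     = rename ρ P ⋆ rename ρ Q

exts : (ℕ → Term) → ℕ → Term
exts s zero    = var zero
exts s (suc n) = rename suc (s n)

subst : (ℕ → Term) → Term → Term
subst s (var n)     = s n
subst s ⟨ P , Q ⟩   = ⟨ subst s P , subst s Q ⟩
subst s (σ₁ P)      = σ₁ (subst s P)
subst s (σ₂ P)      = σ₂ (subst s P)
subst s (lam P)     = lam (subst (exts s) P)
subst s (P ⋆ Q)     = subst s P ⋆ subst s Q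

-- single substitution P[x:=Q], x being de Bruijn index 0
single : Term → ℕ → Term
single Q zero    = Q
single Q (suc n) = var n

_[_] : Term → Term → Term
P [ Q ] = subst (single Q) P

-- contexts: de Bruijn index 0 is the most recently bound variable
Ctx : Set
Ctx = List MType

data _∋_∶_ : Ctx → ℕ → MType → Set where
  here  : ∀ {Γ A} → (A ∷ Γ) ∋ zero ∶ A
  there : ∀ {Γ A B n} → Γ ∋ n ∶ A → (B ∷ Γ) ∋ suc n ∶ A

data _⊢_∶_ : Ctx → Term → Ty → Set where
  ax   : ∀ {Γ n A} → Γ ∋ n ∶ A → Γ ⊢ var n ∶ m A
  pair : ∀ {Γ P₁ P₂ A₁ A₂} → Γ ⊢ P₁ ∶ m A₁ → Γ ⊢ P₂ ∶ m A₂ → Γ ⊢ ⟨ P₁ , P₂ ⟩ ∶ m (A₁ ∧ A₂)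
  inj₁ : ∀ {Γ P A₁ A₂} → Γ ⊢ P ∶ m A₁ → Γ ⊢ σ₁ P ∶ m (A₁ ∨ A₂)
  inj₂ : ∀ {Γ P A₁ A₂} → Γ ⊢ P ∶ m A₂ → Γ ⊢ σ₂ P ∶ m (A₁ ∨ A₂)
  abs  : ∀ {Γ P A} → (A ∷ Γ) ⊢ P ∶ bot → Γ ⊢ lam P ∶ m (A ᗮ)
  cut  : ∀ {Γ P₁ P₂ A} → Γ ⊢ P₁ ∶ m (A ᗮ) → Γ ⊢ P₂ ∶ m A → Γ ⊢ (P₁ ⋆ P₂) ∶ bot

data _⟶_ : Term → Term → Set where
  βl   : ∀ {P Q} → (lam P ⋆ Q) ⟶ (P [ Q ])
  βr   : ∀ {P Q} → (Q ⋆ lam P) ⟶ (P [ Q ])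
  πl₁  : ∀ {P₁ P₂ Q} → (⟨ P₁ , P₂ ⟩ ⋆ σ₁ Q) ⟶ (P₁ ⋆ Q)
  πl₂  : ∀ {P₁ P₂ Q} → (⟨ P₁ , P₂ ⟩ ⋆ σ₂ Q) ⟶ (P₂ ⋆ Q)
  πr₁  : ∀ {P₁ P₂ Q} → (σ₁ Q ⋆ ⟨ P₁ , P₂ ⟩) ⟶ (Q ⋆ P₁)
  πr₂  : ∀ {P₁ P₂ Q} → (σ₂ Q ⋆ ⟨ P₁ , P₂ ⟩) ⟶ (Q ⋆ P₂)
  ξpl  : ∀ {P P' Q} → P ⟶ P' → ⟨ P , Q ⟩ ⟶ ⟨ P' , Q ⟩
  ξpr  : ∀ {P Q Q'} → Q ⟶ Q' → ⟨ P , Q ⟩ ⟶ ⟨ P , Q' ⟩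
  ξσ₁  : ∀ {P P'} → P ⟶ P' → σ₁ P ⟶ σ₁ P'
  ξσ₂  : ∀ {P P'} → P ⟶ P' → σ₂ P ⟶ σ₂ P'
  ξlam : ∀ {P P'} → P ⟶ P' → lam P ⟶ lam P'
  ξcl  : ∀ {P P' Q} → P ⟶ P' → (P ⋆ Q) ⟶ (P' ⋆ Q)
  ξcr  : ∀ {P Q Q'} → Q ⟶ Q' → (P ⋆ Q) ⟶ (P ⋆ Q')

data SN (M : Term) : Set where
  sn : (∀ {M'} → M ⟶ M' → SN M') → SN M

module Submission where

-- The proof is a syntactic reducibility argument.  A pattern o is a typed term
-- whose variables are filled by an environment ρ; an instance of o is obtained by
-- substituting ρ into o and reducing inside the substituted values only (Inst).
-- Patterns are measured by accessibility for _◁_, "is a reduct or an immediate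
-- subterm of", which holds for every strongly normalising term (SN⇒Acc).
--
-- Fix a type B.  A term w : B is a partner at a pattern o if every instance of
-- every B^⊥-pattern strictly ◁-below o is SN when cut against (renamings of) w;
-- environments may only put partners into variables of type B.  By ◁-induction,
-- every instance of a pattern is SN (Candidates.instance-SN): a root contraction
-- inside an instance is a reduct of an instance of a reduct of the pattern
-- (root-lift), and a cut of a filled variable against a subpattern is covered
-- by the partner property.
--
-- Cutting an instance of a B^⊥-pattern against an instance of a B-pattern is SN
-- (Duality.cut-instances): by lexicographic induction on the two patterns each
-- instance is a partner of the other, β-steps are instances again, and π-steps
-- are cuts at a component type of B, handled by structural induction on B
-- (cut-SN).  The theorem is instance-SN for the pattern M with x filled by N,
-- which is a partner at M because cut-SN holds at every type.

open import Data.Nat using (ℕ; zero; suc)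
open import Data.List using (_∷_)
open import Data.Product using (Σ-syntax; _×_; _,_; proj₁; proj₂)
open import Data.Sum using (_⊎_; inj₁; inj₂)
open import Data.Empty using (⊥-elim)
open import Function using (_∘_)
open import Relation.Nullary using (¬_)
open import Relation.Binary.PropositionalEquality
  using (_≡_; refl; sym; trans; cong; cong₂; _≗_) renaming (subst to transport)
open import Relation.Binary.Construct.Closure.ReflexiveTransitive using (Star; ε; _◅_; _◅◅_; gmap)
open import Induction.WellFounded using (Acc; acc; acc-inverse; WfRec)
open import Defs

ᗮ-involutive : ∀ A → (A ᗮ) ᗮ ≡ A
ᗮ-involutive (atom a)  = refl
ᗮ-involutive (natom a) = refl
ᗮ-involutive (A ∧ B)   = cong₂ _∧_ (ᗮ-involutive A) (ᗮ-involutive B)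
ᗮ-involutive (A ∨ B)   = cong₂ _∨_ (ᗮ-involutive A) (ᗮ-involutive B)

ᗮ-injective : ∀ {A B} → A ᗮ ≡ B ᗮ → A ≡ B
ᗮ-injective {A} {B} e = trans (sym (ᗮ-involutive A)) (trans (cong _ᗮ e) (ᗮ-involutive B))

ᗮ-swap : ∀ {A B} → A ᗮ ≡ B → A ≡ B ᗮ
ᗮ-swap {A} e = trans (sym (ᗮ-involutive A)) (cong _ᗮ e)

ᗮ-irreflexive : ∀ A → ¬ (A ≡ A ᗮ)
ᗮ-irreflexive (atom a)  ()
ᗮ-irreflexive (natom a) ()
ᗮ-irreflexive (A ∧ B)   ()
ᗮ-irreflexive (A ∨ B)   ()

-- C ≺ B: C is an immediate component of B; π-steps cut at such types.
data _≺_ : MType → MType → Set where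
  ∧ˡ : ∀ {C D} → C ≺ (C ∧ D)
  ∧ʳ : ∀ {C D} → D ≺ (C ∧ D)
  ∨ˡ : ∀ {C D} → C ≺ (C ∨ D)
  ∨ʳ : ∀ {C D} → D ≺ (C ∨ D)

ext-cong : ∀ {ρ ρ' : ℕ → ℕ} → ρ ≗ ρ' → ext ρ ≗ ext ρ'
ext-cong e zero    = refl
ext-cong e (suc n) = cong suc (e n)

rename-cong : ∀ {ρ ρ' : ℕ → ℕ} → ρ ≗ ρ' → ∀ t → rename ρ t ≡ rename ρ' t
rename-cong e (var x)   = cong var (e x)
rename-cong e ⟨ t , u ⟩ = cong₂ ⟨_,_⟩ (rename-cong e t) (rename-cong e u)
rename-cong e (σ₁ t)    = cong σ₁ (rename-cong e t)
rename-cong e (σ₂ t)    = cong σ₂ (rename-cong e t)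
rename-cong e (lam t)   = cong lam (rename-cong (ext-cong e) t)
rename-cong e (t ⋆ u)   = cong₂ _⋆_ (rename-cong e t) (rename-cong e u)

exts-cong : ∀ {σ σ' : ℕ → Term} → σ ≗ σ' → exts σ ≗ exts σ'
exts-cong e zero    = refl
exts-cong e (suc n) = cong (rename suc) (e n)

subst-cong : ∀ {σ σ' : ℕ → Term} → σ ≗ σ' → ∀ t → subst σ t ≡ subst σ' t
subst-cong e (var x)   = e x
subst-cong e ⟨ t , u ⟩ = cong₂ ⟨_,_⟩ (subst-cong e t) (subst-cong e u)
subst-cong e (σ₁ t)    = cong σ₁ (subst-cong e t)
subst-cong e (σ₂ t)    = cong σ₂ (subst-cong e t)
subst-cong e (lam t)   = cong lam (subst-cong (exts-cong e) t)
subst-cong e (t ⋆ u)   = cong₂ _⋆_ (subst-cong e t) (subst-cong e u)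

rename-rename : ∀ θ ρ t → rename θ (rename ρ t) ≡ rename (θ ∘ ρ) t
rename-rename θ ρ (var x)   = refl
rename-rename θ ρ ⟨ t , u ⟩ = cong₂ ⟨_,_⟩ (rename-rename θ ρ t) (rename-rename θ ρ u)
rename-rename θ ρ (σ₁ t)    = cong σ₁ (rename-rename θ ρ t)
rename-rename θ ρ (σ₂ t)    = cong σ₂ (rename-rename θ ρ t)
rename-rename θ ρ (lam t)   = cong lam (trans (rename-rename (ext θ) (ext ρ) t)
                                              (rename-cong (λ { zero → refl ; (suc n) → refl }) t))
rename-rename θ ρ (t ⋆ u)   = cong₂ _⋆_ (rename-rename θ ρ t) (rename-rename θ ρ u)

subst-rename : ∀ σ ρ t → subst σ (rename ρ t) ≡ subst (σ ∘ ρ) t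
subst-rename σ ρ (var x)   = refl
subst-rename σ ρ ⟨ t , u ⟩ = cong₂ ⟨_,_⟩ (subst-rename σ ρ t) (subst-rename σ ρ u)
subst-rename σ ρ (σ₁ t)    = cong σ₁ (subst-rename σ ρ t)
subst-rename σ ρ (σ₂ t)    = cong σ₂ (subst-rename σ ρ t)
subst-rename σ ρ (lam t)   = cong lam (trans (subst-rename (exts σ) (ext ρ) t)
                                              (subst-cong (λ { zero → refl ; (suc n) → refl }) t))
subst-rename σ ρ (t ⋆ u)   = cong₂ _⋆_ (subst-rename σ ρ t) (subst-rename σ ρ u)

rename-subst : ∀ θ σ t → rename θ (subst σ t) ≡ subst (rename θ ∘ σ) t
rename-subst θ σ (var x)   = refl
rename-subst θ σ ⟨ t , u ⟩ = cong₂ ⟨_,_⟩ (rename-subst θ σ t) (rename-subst θ σ u)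
rename-subst θ σ (σ₁ t)    = cong σ₁ (rename-subst θ σ t)
rename-subst θ σ (σ₂ t)    = cong σ₂ (rename-subst θ σ t)
rename-subst θ σ (lam t)   = cong lam (trans (rename-subst (ext θ) (exts σ) t) (subst-cong shift t))
  where
  shift : rename (ext θ) ∘ exts σ ≗ exts (rename θ ∘ σ)
  shift zero    = refl
  shift (suc n) = trans (rename-rename (ext θ) suc (σ n)) (sym (rename-rename suc θ (σ n)))
rename-subst θ σ (t ⋆ u)   = cong₂ _⋆_ (rename-subst θ σ t) (rename-subst θ σ u)

exts-shift : ∀ τ t → subst (exts τ) (rename suc t) ≡ rename suc (subst τ t)
exts-shift τ t = trans (subst-rename (exts τ) suc t) (sym (rename-subst suc τ t))

subst-subst : ∀ τ σ t → subst τ (subst σ t) ≡ subst (subst τ ∘ σ) t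
subst-subst τ σ (var x)   = refl
subst-subst τ σ ⟨ t , u ⟩ = cong₂ ⟨_,_⟩ (subst-subst τ σ t) (subst-subst τ σ u)
subst-subst τ σ (σ₁ t)    = cong σ₁ (subst-subst τ σ t)
subst-subst τ σ (σ₂ t)    = cong σ₂ (subst-subst τ σ t)
subst-subst τ σ (lam t)   = cong lam (trans (subst-subst (exts τ) (exts σ) t)
                                            (subst-cong shift t))
  where
  shift : subst (exts τ) ∘ exts σ ≗ exts (subst τ ∘ σ)
  shift zero    = refl
  shift (suc n) = exts-shift τ (σ n)
subst-subst τ σ (t ⋆ u)   = cong₂ _⋆_ (subst-subst τ σ t) (subst-subst τ σ u)

rename-as-subst : ∀ θ t → rename θ t ≡ subst (var ∘ θ) t
rename-as-subst θ (var x)   = refl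
rename-as-subst θ ⟨ t , u ⟩ = cong₂ ⟨_,_⟩ (rename-as-subst θ t) (rename-as-subst θ u)
rename-as-subst θ (σ₁ t)    = cong σ₁ (rename-as-subst θ t)
rename-as-subst θ (σ₂ t)    = cong σ₂ (rename-as-subst θ t)
rename-as-subst θ (lam t)   = cong lam (trans (rename-as-subst (ext θ) t)
                                              (subst-cong (λ { zero → refl ; (suc n) → refl }) t))
rename-as-subst θ (t ⋆ u)   = cong₂ _⋆_ (rename-as-subst θ t) (rename-as-subst θ u)

subst-id : ∀ {σ} → σ ≗ var → ∀ t → subst σ t ≡ t
subst-id e (var x)   = e x
subst-id e ⟨ t , u ⟩ = cong₂ ⟨_,_⟩ (subst-id e t) (subst-id e u)
subst-id e (σ₁ t)    = cong σ₁ (subst-id e t)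
subst-id e (σ₂ t)    = cong σ₂ (subst-id e t)
subst-id e (lam t)   = cong lam (subst-id (λ { zero → refl ; (suc n) → cong (rename suc) (e n) }) t)
subst-id e (t ⋆ u)   = cong₂ _⋆_ (subst-id e t) (subst-id e u)

rename-id : ∀ t → rename (λ n → n) t ≡ t
rename-id t = trans (rename-as-subst _ t) (subst-id (λ _ → refl) t)

single-shift : ∀ Q t → rename suc t [ Q ] ≡ t
single-shift Q t = trans (subst-rename (single Q) suc t) (subst-id (λ _ → refl) t)

subst-single : ∀ σ P Q → subst σ (P [ Q ]) ≡ subst (exts σ) P [ subst σ Q ]
subst-single σ P Q = trans (subst-subst σ (single Q) P)
  (trans (subst-cong pointwise P) (sym (subst-subst (single (subst σ Q)) (exts σ) P)))
  where
  pointwise : subst σ ∘ single Q ≗ subst (single (subst σ Q)) ∘ exts σ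
  pointwise zero    = refl
  pointwise (suc n) = sym (single-shift (subst σ Q) (σ n))

rename-single : ∀ θ P Q → rename θ (P [ Q ]) ≡ rename (ext θ) P [ rename θ Q ]
rename-single θ P Q = trans (rename-as-subst θ (P [ Q ]))
  (trans (subst-single (var ∘ θ) P Q)
         (cong₂ _[_] (trans (subst-cong (λ { zero → refl ; (suc n) → refl }) P)
                            (sym (rename-as-subst (ext θ) P)))
                     (sym (rename-as-subst θ Q))))

data Switch : Term → Term → Term → Term → Set where
  πˡ₁ : ∀ {P₁ P₂ Q} → Switch ⟨ P₁ , P₂ ⟩ (σ₁ Q) P₁ Q
  πˡ₂ : ∀ {P₁ P₂ Q} → Switch ⟨ P₁ , P₂ ⟩ (σ₂ Q) P₂ Q
  πʳ₁ : ∀ {P₁ P₂ Q} → Switch (σ₁ Q) ⟨ P₁ , P₂ ⟩ Q P₁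
  πʳ₂ : ∀ {P₁ P₂ Q} → Switch (σ₂ Q) ⟨ P₁ , P₂ ⟩ Q P₂

data _⊳_ : Term → Term → Set where
  βˡ : ∀ {P Q} → (lam P ⋆ Q) ⊳ (P [ Q ])
  βʳ : ∀ {P Q} → (Q ⋆ lam P) ⊳ (P [ Q ])
  π  : ∀ {a b u v} → Switch a b u v → (a ⋆ b) ⊳ (u ⋆ v)

⊳⇒⟶ : ∀ {t u} → t ⊳ u → t ⟶ u
⊳⇒⟶ βˡ        = βl
⊳⇒⟶ βʳ        = βr
⊳⇒⟶ (π πˡ₁) = πl₁
⊳⇒⟶ (π πˡ₂) = πl₂
⊳⇒⟶ (π πʳ₁) = πr₁
⊳⇒⟶ (π πʳ₂) = πr₂

castT : ∀ {Γ t A B} → A ≡ B → Γ ⊢ t ∶ m A → Γ ⊢ t ∶ m B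
castT {Γ} {t} e = transport (λ X → Γ ⊢ t ∶ m X) e

TRen : (ℕ → ℕ) → Ctx → Ctx → Set
TRen θ Γ Γ' = ∀ {n A} → Γ ∋ n ∶ A → Γ' ∋ θ n ∶ A

TRen-ext : ∀ {θ Γ Γ' C} → TRen θ Γ Γ' → TRen (ext θ) (C ∷ Γ) (C ∷ Γ')
TRen-ext r here      = here
TRen-ext r (there x) = there (r x)

⊢-rename : ∀ {θ Γ Γ' t T} → TRen θ Γ Γ' → Γ ⊢ t ∶ T → Γ' ⊢ rename θ t ∶ T
⊢-rename r (ax x)     = ax (r x)
⊢-rename r (pair d e) = pair (⊢-rename r d) (⊢-rename r e)
⊢-rename r (inj₁ d)   = inj₁ (⊢-rename r d)
⊢-rename r (inj₂ d)   = inj₂ (⊢-rename r d)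
⊢-rename r (abs d)    = abs (⊢-rename (TRen-ext r) d)
⊢-rename r (cut d e)  = cut (⊢-rename r d) (⊢-rename r e)

TSub : (ℕ → Term) → Ctx → Ctx → Set
TSub σ Γ Γ' = ∀ {n A} → Γ ∋ n ∶ A → Γ' ⊢ σ n ∶ m A

TSub-exts : ∀ {σ Γ Γ' C} → TSub σ Γ Γ' → TSub (exts σ) (C ∷ Γ) (C ∷ Γ')
TSub-exts s here      = ax here
TSub-exts s (there x) = ⊢-rename there (s x)

⊢-subst : ∀ {σ Γ Γ' t T} → TSub σ Γ Γ' → Γ ⊢ t ∶ T → Γ' ⊢ subst σ t ∶ T
⊢-subst s (ax x)     = s x
⊢-subst s (pair d e) = pair (⊢-subst s d) (⊢-subst s e)
⊢-subst s (inj₁ d)   = inj₁ (⊢-subst s d)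
⊢-subst s (inj₂ d)   = inj₂ (⊢-subst s d)
⊢-subst s (abs d)    = abs (⊢-subst (TSub-exts s) d)
⊢-subst s (cut d e)  = cut (⊢-subst s d) (⊢-subst s e)

⊢-single : ∀ {Γ P Q C T} → (C ∷ Γ) ⊢ P ∶ T → Γ ⊢ Q ∶ m C → Γ ⊢ P [ Q ] ∶ T
⊢-single d q = ⊢-subst (λ { here → q ; (there x) → ax x }) d

-- The type of an abstraction is a dual, so it cannot be matched on directly.
inv-abs : ∀ {Γ P X} → Γ ⊢ lam P ∶ m X → Σ[ C ∈ MType ] X ≡ C ᗮ × (C ∷ Γ) ⊢ P ∶ bot
inv-abs (abs d) = _ , refl , d

switch-typing : ∀ {Γ a b u v B} → Switch a b u v → Γ ⊢ a ∶ m (B ᗮ) → Γ ⊢ b ∶ m B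
  → Σ[ C ∈ MType ] C ≺ B × Γ ⊢ u ∶ m (C ᗮ) × Γ ⊢ v ∶ m C
switch-typing πˡ₁ (pair d₁ d₂) (inj₁ e) = _ , ∨ˡ , d₁ , e
switch-typing πˡ₂ (pair d₁ d₂) (inj₂ e) = _ , ∨ʳ , d₂ , e
switch-typing πʳ₁ (inj₁ d) (pair e₁ e₂) = _ , ∧ˡ , d , e₁
switch-typing πʳ₂ (inj₂ d) (pair e₁ e₂) = _ , ∧ʳ , d , e₂

⊳-typing : ∀ {Γ t u} → Γ ⊢ t ∶ bot → t ⊳ u → Γ ⊢ u ∶ bot
⊳-typing (cut d e) βˡ with inv-abs d
... | C , eq , dP = ⊢-single dP (castT (ᗮ-injective eq) e)
⊳-typing (cut d e) βʳ with inv-abs e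
... | C , eq , dP = ⊢-single dP (castT (sym (ᗮ-swap (sym eq))) d)
⊳-typing (cut d e) (π s) with switch-typing s d e
... | _ , _ , du , dv = cut du dv

subject-reduction : ∀ {Γ t t' T} → Γ ⊢ t ∶ T → t ⟶ t' → Γ ⊢ t' ∶ T
subject-reduction d@(cut _ _) βl  = ⊳-typing d βˡ
subject-reduction d@(cut _ _) βr  = ⊳-typing d βʳ
subject-reduction d@(cut _ _) πl₁ = ⊳-typing d (π πˡ₁)
subject-reduction d@(cut _ _) πl₂ = ⊳-typing d (π πˡ₂)
subject-reduction d@(cut _ _) πr₁ = ⊳-typing d (π πʳ₁)
subject-reduction d@(cut _ _) πr₂ = ⊳-typing d (π πʳ₂)
subject-reduction (pair d e) (ξpl r) = pair (subject-reduction d r) e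
subject-reduction (pair d e) (ξpr r) = pair d (subject-reduction e r)
subject-reduction (inj₁ d)   (ξσ₁ r) = inj₁ (subject-reduction d r)
subject-reduction (inj₂ d)   (ξσ₂ r) = inj₂ (subject-reduction d r)
subject-reduction (abs d)    (ξlam r) = abs (subject-reduction d r)
subject-reduction (cut d e)  (ξcl r) = cut (subject-reduction d r) e
subject-reduction (cut d e)  (ξcr r) = cut d (subject-reduction e r)

infix 4 _↠_
_↠_ : Term → Term → Set
_↠_ = Star _⟶_

↠-lam : ∀ {P P'} → P ↠ P' → lam P ↠ lam P'
↠-lam = gmap lam ξlam

↠-σ₁ : ∀ {P P'} → P ↠ P' → σ₁ P ↠ σ₁ P'
↠-σ₁ = gmap σ₁ ξσ₁

↠-σ₂ : ∀ {P P'} → P ↠ P' → σ₂ P ↠ σ₂ P'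
↠-σ₂ = gmap σ₂ ξσ₂

↠-pair : ∀ {P P' Q Q'} → P ↠ P' → Q ↠ Q' → ⟨ P , Q ⟩ ↠ ⟨ P' , Q' ⟩
↠-pair {Q = Q} p q = gmap ⟨_, Q ⟩ ξpl p ◅◅ gmap ⟨ _ ,_⟩ ξpr q

↠-cut : ∀ {P P' Q Q'} → P ↠ P' → Q ↠ Q' → (P ⋆ Q) ↠ (P' ⋆ Q')
↠-cut {Q = Q} p q = gmap (_⋆ Q) ξcl p ◅◅ gmap (_ ⋆_) ξcr q

subject-reduction* : ∀ {Γ t t' T} → Γ ⊢ t ∶ T → t ↠ t' → Γ ⊢ t' ∶ T
subject-reduction* d ε       = d
subject-reduction* d (r ◅ p) = subject-reduction* (subject-reduction d r) p

⟶-subst : ∀ σ {t t'} → t ⟶ t' → subst σ t ⟶ subst σ t'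
⟶-subst σ (βl {P} {Q}) rewrite subst-single σ P Q = βl
⟶-subst σ (βr {P} {Q}) rewrite subst-single σ P Q = βr
⟶-subst σ πl₁      = πl₁
⟶-subst σ πl₂      = πl₂
⟶-subst σ πr₁      = πr₁
⟶-subst σ πr₂      = πr₂
⟶-subst σ (ξpl r)  = ξpl (⟶-subst σ r)
⟶-subst σ (ξpr r)  = ξpr (⟶-subst σ r)
⟶-subst σ (ξσ₁ r)  = ξσ₁ (⟶-subst σ r)
⟶-subst σ (ξσ₂ r)  = ξσ₂ (⟶-subst σ r)
⟶-subst σ (ξlam r) = ξlam (⟶-subst (exts σ) r)
⟶-subst σ (ξcl r)  = ξcl (⟶-subst σ r)
⟶-subst σ (ξcr r)  = ξcr (⟶-subst σ r)

⟶-rename : ∀ θ {t t'} → t ⟶ t' → rename θ t ⟶ rename θ t'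
⟶-rename θ {t} {t'} r rewrite rename-as-subst θ t | rename-as-subst θ t' = ⟶-subst (var ∘ θ) r

↠-rename : ∀ θ {t t'} → t ↠ t' → rename θ t ↠ rename θ t'
↠-rename θ = gmap (rename θ) (⟶-rename θ)

↠-subst : ∀ σ {t t'} → t ↠ t' → subst σ t ↠ subst σ t'
↠-subst σ = gmap (subst σ) (⟶-subst σ)

↠-substs : ∀ {σ τ} → (∀ n → σ n ↠ τ n) → ∀ t → subst σ t ↠ subst τ t
↠-substs h (var x)   = h x
↠-substs h ⟨ t , u ⟩ = ↠-pair (↠-substs h t) (↠-substs h u)
↠-substs h (σ₁ t)    = ↠-σ₁ (↠-substs h t)
↠-substs h (σ₂ t)    = ↠-σ₂ (↠-substs h t)
↠-substs h (lam t)   = ↠-lam (↠-substs (λ { zero → ε ; (suc n) → ↠-rename suc (h n) }) t)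
↠-substs h (t ⋆ u)   = ↠-cut (↠-substs h t) (↠-substs h u)

↠-single : ∀ {P P' Q Q'} → P ↠ P' → Q ↠ Q' → P [ Q ] ↠ P' [ Q' ]
↠-single {P} {Q' = Q'} p q = ↠-substs (λ { zero → q ; (suc n) → ε }) P ◅◅ ↠-subst (single Q') p

var↠ : ∀ {x t} → var x ↠ t → t ≡ var x
var↠ ε        = refl
var↠ (() ◅ _)

lam↠ : ∀ {P t} → lam P ↠ t → Σ[ P' ∈ Term ] t ≡ lam P' × P ↠ P'
lam↠ ε              = _ , refl , ε
lam↠ (ξlam r ◅ p) with lam↠ p
... | P' , refl , q = P' , refl , r ◅ q

σ₁↠ : ∀ {P t} → σ₁ P ↠ t → Σ[ P' ∈ Term ] t ≡ σ₁ P' × P ↠ P'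
σ₁↠ ε             = _ , refl , ε
σ₁↠ (ξσ₁ r ◅ p) with σ₁↠ p
... | P' , refl , q = P' , refl , r ◅ q

σ₂↠ : ∀ {P t} → σ₂ P ↠ t → Σ[ P' ∈ Term ] t ≡ σ₂ P' × P ↠ P'
σ₂↠ ε             = _ , refl , ε
σ₂↠ (ξσ₂ r ◅ p) with σ₂↠ p
... | P' , refl , q = P' , refl , r ◅ q

pair↠ : ∀ {P Q t} → ⟨ P , Q ⟩ ↠ t
  → Σ[ P' ∈ Term ] Σ[ Q' ∈ Term ] t ≡ ⟨ P' , Q' ⟩ × P ↠ P' × Q ↠ Q'
pair↠ ε             = _ , _ , refl , ε , ε
pair↠ (ξpl r ◅ p) with pair↠ p
... | P' , Q' , refl , p₁ , p₂ = P' , Q' , refl , r ◅ p₁ , p₂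
pair↠ (ξpr r ◅ p) with pair↠ p
... | P' , Q' , refl , p₁ , p₂ = P' , Q' , refl , p₁ , r ◅ p₂

-- Renaming reflects reduction.  Renames θ t u is the graph of rename θ, on
-- which the shape of u can be inverted by pattern matching.

data Renames : (ℕ → ℕ) → Term → Term → Set where
  var  : ∀ {θ x} → Renames θ (var x) (var (θ x))
  pair : ∀ {θ t₁ t₂ u₁ u₂} → Renames θ t₁ u₁ → Renames θ t₂ u₂
       → Renames θ ⟨ t₁ , t₂ ⟩ ⟨ u₁ , u₂ ⟩
  σ₁   : ∀ {θ t u} → Renames θ t u → Renames θ (σ₁ t) (σ₁ u)
  σ₂   : ∀ {θ t u} → Renames θ t u → Renames θ (σ₂ t) (σ₂ u)
  lam  : ∀ {θ t u} → Renames (ext θ) t u → Renames θ (lam t) (lam u)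
  cut  : ∀ {θ t₁ t₂ u₁ u₂} → Renames θ t₁ u₁ → Renames θ t₂ u₂
       → Renames θ (t₁ ⋆ t₂) (u₁ ⋆ u₂)

renames : ∀ θ t → Renames θ t (rename θ t)
renames θ (var x)   = var
renames θ ⟨ t , u ⟩ = pair (renames θ t) (renames θ u)
renames θ (σ₁ t)    = σ₁ (renames θ t)
renames θ (σ₂ t)    = σ₂ (renames θ t)
renames θ (lam t)   = lam (renames (ext θ) t)
renames θ (t ⋆ u)   = cut (renames θ t) (renames θ u)

renames⇒≡ : ∀ {θ t u} → Renames θ t u → u ≡ rename θ t
renames⇒≡ var        = refl
renames⇒≡ (pair g h) = cong₂ ⟨_,_⟩ (renames⇒≡ g) (renames⇒≡ h)
renames⇒≡ (σ₁ g)     = cong σ₁ (renames⇒≡ g)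
renames⇒≡ (σ₂ g)     = cong σ₂ (renames⇒≡ g)
renames⇒≡ (lam g)    = cong lam (renames⇒≡ g)
renames⇒≡ (cut g h)  = cong₂ _⋆_ (renames⇒≡ g) (renames⇒≡ h)

renames-β : ∀ {θ t₁ t₂ P Q} → Renames (ext θ) t₁ P → Renames θ t₂ Q
  → Renames θ (t₁ [ t₂ ]) (P [ Q ])
renames-β {θ} {t₁} {t₂} g h = transport (Renames θ (t₁ [ t₂ ]))
  (trans (rename-single θ t₁ t₂) (sym (cong₂ _[_] (renames⇒≡ g) (renames⇒≡ h))))
  (renames θ (t₁ [ t₂ ]))

ren-inv : ∀ {θ t u s} → Renames θ t u → u ⟶ s → Σ[ t' ∈ Term ] t ⟶ t' × Renames θ t' s
ren-inv (cut (lam g) h) βl               = _ , βl , renames-β g h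
ren-inv (cut h (lam g)) βr               = _ , βr , renames-β g h
ren-inv (cut (pair g₁ g₂) (σ₁ h)) πl₁    = _ , πl₁ , cut g₁ h
ren-inv (cut (pair g₁ g₂) (σ₂ h)) πl₂    = _ , πl₂ , cut g₂ h
ren-inv (cut (σ₁ h) (pair g₁ g₂)) πr₁    = _ , πr₁ , cut h g₁
ren-inv (cut (σ₂ h) (pair g₁ g₂)) πr₂    = _ , πr₂ , cut h g₂
ren-inv (pair g h) (ξpl r) with ren-inv g r
... | t' , r' , g' = _ , ξpl r' , pair g' h
ren-inv (pair g h) (ξpr r) with ren-inv h r
... | t' , r' , h' = _ , ξpr r' , pair g h'
ren-inv (σ₁ g) (ξσ₁ r) with ren-inv g r
... | t' , r' , g' = _ , ξσ₁ r' , σ₁ g'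
ren-inv (σ₂ g) (ξσ₂ r) with ren-inv g r
... | t' , r' , g' = _ , ξσ₂ r' , σ₂ g'
ren-inv (lam g) (ξlam r) with ren-inv g r
... | t' , r' , g' = _ , ξlam r' , lam g'
ren-inv (cut g h) (ξcl r) with ren-inv g r
... | t' , r' , g' = _ , ξcl r' , cut g' h
ren-inv (cut g h) (ξcr r) with ren-inv h r
... | t' , r' , h' = _ , ξcr r' , cut g h'

ren-inv* : ∀ {θ t u s} → Renames θ t u → u ↠ s → Σ[ t' ∈ Term ] t ↠ t' × Renames θ t' s
ren-inv* g ε = _ , ε , g
ren-inv* g (r ◅ p) with ren-inv g r
... | _ , r' , g' with ren-inv* g' p
...   | t' , p' , g'' = t' , r' ◅ p' , g''

↠-rename-inv : ∀ θ t {s} → rename θ t ↠ s → Σ[ t' ∈ Term ] t ↠ t' × s ≡ rename θ t'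
↠-rename-inv θ t p with ren-inv* (renames θ t) p
... | t' , p' , g = t' , p' , renames⇒≡ g

SN-↠ : ∀ {t t'} → SN t → t ↠ t' → SN t'
SN-↠ s      ε       = s
SN-↠ (sn f) (r ◅ p) = SN-↠ (f r) p

SN-var : ∀ {n} → SN (var n)
SN-var = sn λ ()

SN-lam : ∀ {P} → SN P → SN (lam P)
SN-lam (sn f) = sn λ { (ξlam r) → SN-lam (f r) }

SN-σ₁ : ∀ {P} → SN P → SN (σ₁ P)
SN-σ₁ (sn f) = sn λ { (ξσ₁ r) → SN-σ₁ (f r) }

SN-σ₂ : ∀ {P} → SN P → SN (σ₂ P)
SN-σ₂ (sn f) = sn λ { (ξσ₂ r) → SN-σ₂ (f r) }

SN-pair : ∀ {P Q} → SN P → SN Q → SN ⟨ P , Q ⟩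
SN-pair (sn f) (sn g) = sn λ { (ξpl r) → SN-pair (f r) (sn g) ; (ξpr r) → SN-pair (sn f) (g r) }

SN-pair⁻ : ∀ {P Q} → SN ⟨ P , Q ⟩ → SN P × SN Q
SN-pair⁻ s = left s , right s
  where
  left : ∀ {P Q} → SN ⟨ P , Q ⟩ → SN P
  left (sn f) = sn λ r → left (f (ξpl r))
  right : ∀ {P Q} → SN ⟨ P , Q ⟩ → SN Q
  right (sn f) = sn λ r → right (f (ξpr r))

SN-σ₁⁻ : ∀ {P} → SN (σ₁ P) → SN P
SN-σ₁⁻ (sn f) = sn λ r → SN-σ₁⁻ (f (ξσ₁ r))

SN-σ₂⁻ : ∀ {P} → SN (σ₂ P) → SN P
SN-σ₂⁻ (sn f) = sn λ r → SN-σ₂⁻ (f (ξσ₂ r))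

switch-SN : ∀ {a b u v} → Switch a b u v → SN a → SN b → SN u × SN v
switch-SN πˡ₁ sa sb = proj₁ (SN-pair⁻ sa) , SN-σ₁⁻ sb
switch-SN πˡ₂ sa sb = proj₂ (SN-pair⁻ sa) , SN-σ₂⁻ sb
switch-SN πʳ₁ sa sb = SN-σ₁⁻ sa , proj₁ (SN-pair⁻ sb)
switch-SN πʳ₂ sa sb = SN-σ₂⁻ sa , proj₂ (SN-pair⁻ sb)

SN-renames : ∀ {θ t u} → Renames θ t u → SN t → SN u
SN-renames g (sn f) = sn λ r → let (_ , r' , g') = ren-inv g r in SN-renames g' (f r')

SN-rename : ∀ θ {t} → SN t → SN (rename θ t)
SN-rename θ = SN-renames (renames θ _)

-- The rules are symmetric in the two sides of a cut.
SN-swap : ∀ {a b} → SN (a ⋆ b) → SN (b ⋆ a)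
SN-swap (sn f) = sn λ where
  βl      → f βr
  βr      → f βl
  πl₁     → SN-swap (f πr₁)
  πl₂     → SN-swap (f πr₂)
  πr₁     → SN-swap (f πl₁)
  πr₂     → SN-swap (f πl₂)
  (ξcl r) → SN-swap (f (ξcr r))
  (ξcr r) → SN-swap (f (ξcl r))

cutSN : ∀ {a b} → SN a → SN b
  → (∀ {a' b' c} → a ↠ a' → b ↠ b' → (a' ⋆ b') ⊳ c → SN c) → SN (a ⋆ b)
cutSN (sn fa) (sn fb) h = sn λ where
  βl      → h ε ε βˡ
  βr      → h ε ε βʳ
  πl₁     → h ε ε (π πˡ₁)
  πl₂     → h ε ε (π πˡ₂)
  πr₁     → h ε ε (π πʳ₁)
  πr₂     → h ε ε (π πʳ₂)
  (ξcl r) → cutSN (fa r) (sn fb) (λ q₁ → h (r ◅ q₁))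
  (ξcr r) → cutSN (sn fa) (fb r) (λ q₁ q₂ → h q₁ (r ◅ q₂))

data _◁_ : Term → Term → Set where
  red   : ∀ {t y} → t ⟶ y → y ◁ t
  pairˡ : ∀ {P Q} → P ◁ ⟨ P , Q ⟩
  pairʳ : ∀ {P Q} → Q ◁ ⟨ P , Q ⟩
  arg₁  : ∀ {P} → P ◁ σ₁ P
  arg₂  : ∀ {P} → P ◁ σ₂ P
  body  : ∀ {P} → P ◁ lam P
  cutˡ  : ∀ {P Q} → P ◁ (P ⋆ Q)
  cutʳ  : ∀ {P Q} → Q ◁ (P ⋆ Q)

-- If all reducts of t are accessible, so is t: a reduct of an immediate
-- subterm is an immediate subterm of a reduct.
mutual
  Acc-from-reducts : ∀ {t} → (∀ {t'} → t ⟶ t' → Acc _◁_ t') → Acc _◁_ t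
  Acc-from-reducts h = acc (Acc-below h)

  Acc-below : ∀ {t} → (∀ {t'} → t ⟶ t' → Acc _◁_ t') → WfRec _◁_ (Acc _◁_) t
  Acc-below h (red r) = h r
  Acc-below h pairˡ   = Acc-from-reducts λ r → acc-inverse (h (ξpl r)) pairˡ
  Acc-below h pairʳ   = Acc-from-reducts λ r → acc-inverse (h (ξpr r)) pairʳ
  Acc-below h arg₁    = Acc-from-reducts λ r → acc-inverse (h (ξσ₁ r)) arg₁
  Acc-below h arg₂    = Acc-from-reducts λ r → acc-inverse (h (ξσ₂ r)) arg₂
  Acc-below h body    = Acc-from-reducts λ r → acc-inverse (h (ξlam r)) body
  Acc-below h cutˡ    = Acc-from-reducts λ r → acc-inverse (h (ξcl r)) cutˡ
  Acc-below h cutʳ    = Acc-from-reducts λ r → acc-inverse (h (ξcr r)) cutʳ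

SN⇒Acc : ∀ {t} → SN t → Acc _◁_ t
SN⇒Acc (sn f) = Acc-from-reducts λ r → SN⇒Acc (f r)

-- Instances of patterns.  Inst ρ o a: a is o with every variable n replaced by
-- some reduct of ρ n (different occurrences may be reduced differently).

data Inst : (ℕ → Term) → Term → Term → Set where
  ivar  : ∀ {ρ n t} → ρ n ↠ t → Inst ρ (var n) t
  ipair : ∀ {ρ P P' Q Q'} → Inst ρ P P' → Inst ρ Q Q' → Inst ρ ⟨ P , Q ⟩ ⟨ P' , Q' ⟩
  iσ₁   : ∀ {ρ P P'} → Inst ρ P P' → Inst ρ (σ₁ P) (σ₁ P')
  iσ₂   : ∀ {ρ P P'} → Inst ρ P P' → Inst ρ (σ₂ P) (σ₂ P')
  ilam  : ∀ {ρ P P'} → Inst (exts ρ) P P' → Inst ρ (lam P) (lam P')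
  icut  : ∀ {ρ P P' Q Q'} → Inst ρ P P' → Inst ρ Q Q' → Inst ρ (P ⋆ Q) (P' ⋆ Q')

Inst↠ : (ℕ → Term) → Term → Term → Set
Inst↠ ρ o c = Σ[ a ∈ Term ] Inst ρ o a × a ↠ c

Inst-refl : ∀ ρ o → Inst ρ o (subst ρ o)
Inst-refl ρ (var x)   = ivar ε
Inst-refl ρ ⟨ o , p ⟩ = ipair (Inst-refl ρ o) (Inst-refl ρ p)
Inst-refl ρ (σ₁ o)    = iσ₁ (Inst-refl ρ o)
Inst-refl ρ (σ₂ o)    = iσ₂ (Inst-refl ρ o)
Inst-refl ρ (lam o)   = ilam (Inst-refl (exts ρ) o)
Inst-refl ρ (o ⋆ p)   = icut (Inst-refl ρ o) (Inst-refl ρ p)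

Inst-id : ∀ {t} → Inst var t t
Inst-id {t} = transport (Inst var t) (subst-id (λ _ → refl) t) (Inst-refl var t)

Inst-rename : ∀ {ρ ρ' φ θ o a} → Inst ρ o a → (∀ n → ρ' (φ n) ≡ rename θ (ρ n))
  → Inst ρ' (rename φ o) (rename θ a)
Inst-rename {θ = θ} (ivar {n = n} p) e = ivar (transport (_↠ _) (sym (e n)) (↠-rename θ p))
Inst-rename (ipair i j) e = ipair (Inst-rename i e) (Inst-rename j e)
Inst-rename (iσ₁ i) e     = iσ₁ (Inst-rename i e)
Inst-rename (iσ₂ i) e     = iσ₂ (Inst-rename i e)
Inst-rename {ρ} {ρ'} {φ} {θ} (ilam i) e = ilam (Inst-rename i e')
  where
  e' : ∀ n → exts ρ' (ext φ n) ≡ rename (ext θ) (exts ρ n)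
  e' zero    = refl
  e' (suc n) = trans (cong (rename suc) (e n))
                     (trans (rename-rename suc θ (ρ n)) (sym (rename-rename (ext θ) suc (ρ n))))
Inst-rename (icut i j) e  = icut (Inst-rename i e) (Inst-rename j e)

Inst-rename-values : ∀ {ρ o a} θ → Inst ρ o a → Inst (rename θ ∘ ρ) o (rename θ a)
Inst-rename-values {o = o} θ i =
  transport (λ p → Inst _ p _) (rename-id o) (Inst-rename i (λ _ → refl))

Inst-subst : ∀ {ρ₁ ρ₂ σ τ o a} → Inst ρ₁ o a
  → (∀ n {t} → ρ₁ n ↠ t → Inst ρ₂ (σ n) (subst τ t))
  → Inst ρ₂ (subst σ o) (subst τ a)
Inst-subst (ivar {n = n} p) H = H n p
Inst-subst (ipair i j) H = ipair (Inst-subst i H) (Inst-subst j H)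
Inst-subst (iσ₁ i) H     = iσ₁ (Inst-subst i H)
Inst-subst (iσ₂ i) H     = iσ₂ (Inst-subst i H)
Inst-subst {ρ₁} {ρ₂} {σ} {τ} (ilam i) H = ilam (Inst-subst i H')
  where
  H' : ∀ n {t} → exts ρ₁ n ↠ t → Inst (exts ρ₂) (exts σ n) (subst (exts τ) t)
  H' zero p with var↠ p
  ... | refl = ivar ε
  H' (suc n) p with ↠-rename-inv suc (ρ₁ n) p
  ... | t' , p' , refl = transport (Inst (exts ρ₂) (rename suc (σ n))) (sym (exts-shift τ t'))
                                   (Inst-rename (H n p') (λ _ → refl))
Inst-subst (icut i j) H  = icut (Inst-subst i H) (Inst-subst j H)

Inst-β : ∀ {ρ O P o a} → Inst (exts ρ) O P → Inst ρ o a → Inst ρ (O [ o ]) (P [ a ])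
Inst-β {ρ} {a = a} i j = Inst-subst i H
  where
  H : ∀ n {t} → exts ρ n ↠ t → Inst ρ (single _ n) (t [ a ])
  H zero p with var↠ p
  ... | refl = j
  H (suc n) p with ↠-rename-inv suc (ρ n) p
  ... | t' , p' , refl = transport (Inst ρ (var n)) (sym (single-shift a t')) (ivar p')

_∷ₛ_ : Term → (ℕ → Term) → ℕ → Term
(b ∷ₛ ρ) zero    = b
(b ∷ₛ ρ) (suc n) = ρ n

Inst-bind : ∀ {ρ O P b} → Inst (exts ρ) O P → Inst (b ∷ₛ ρ) O (P [ b ])
Inst-bind {ρ} {O} {P} {b} i =
  transport (λ o → Inst (b ∷ₛ ρ) o (P [ b ])) (subst-id (λ _ → refl) O) (Inst-subst i H)
  where
  H : ∀ n {t} → exts ρ n ↠ t → Inst (b ∷ₛ ρ) (var n) (t [ b ])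
  H zero p with var↠ p
  ... | refl = ivar ε
  H (suc n) p with ↠-rename-inv suc (ρ n) p
  ... | t' , p' , refl = transport (Inst (b ∷ₛ ρ) (var (suc n))) (sym (single-shift b t')) (ivar p')

TypedEnv : (ℕ → Term) → Ctx → Ctx → Set
TypedEnv ρ Δ Γ = ∀ {n C} → Δ ∋ n ∶ C → ∀ {t} → ρ n ↠ t → Γ ⊢ t ∶ m C

TypedEnv-exts : ∀ {ρ Δ Γ C} → TypedEnv ρ Δ Γ → TypedEnv (exts ρ) (C ∷ Δ) (C ∷ Γ)
TypedEnv-exts H here p with var↠ p
... | refl = ax here
TypedEnv-exts {ρ} H (there {n = n} x) p with ↠-rename-inv suc (ρ n) p
... | t' , p' , refl = ⊢-rename there (H x p')

Inst-⊢ : ∀ {ρ o a Δ Γ T} → TypedEnv ρ Δ Γ → Inst ρ o a → Δ ⊢ o ∶ T → Γ ⊢ a ∶ T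
Inst-⊢ H (ivar p)    (ax x)     = H x p
Inst-⊢ H (ipair i j) (pair d e) = pair (Inst-⊢ H i d) (Inst-⊢ H j e)
Inst-⊢ H (iσ₁ i)     (inj₁ d)   = inj₁ (Inst-⊢ H i d)
Inst-⊢ H (iσ₂ i)     (inj₂ d)   = inj₂ (Inst-⊢ H i d)
Inst-⊢ H (ilam i)    (abs d)    = abs (Inst-⊢ (TypedEnv-exts H) i d)
Inst-⊢ H (icut i j)  (cut d e)  = cut (Inst-⊢ H i d) (Inst-⊢ H j e)

-- Heads of instances.  When the pattern o is not a variable filled by a proper
-- value, reducts of its instances have the same head constructor as o.

NV : (ℕ → Term) → Term → Set
NV ρ o = ∀ {n} → o ≡ var n → Σ[ x ∈ ℕ ] ρ n ≡ var x

data Head (ρ : ℕ → Term) : Term → Term → Set where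
  hvar  : ∀ {n x} → Head ρ (var n) (var x)
  hpair : ∀ {o₁ o₂ c₁ c₂} → Inst↠ ρ o₁ c₁ → Inst↠ ρ o₂ c₂
        → Head ρ ⟨ o₁ , o₂ ⟩ ⟨ c₁ , c₂ ⟩
  hσ₁   : ∀ {o c} → Inst↠ ρ o c → Head ρ (σ₁ o) (σ₁ c)
  hσ₂   : ∀ {o c} → Inst↠ ρ o c → Head ρ (σ₂ o) (σ₂ c)
  hlam  : ∀ {o c} → Inst↠ (exts ρ) o c → Head ρ (lam o) (lam c)

-- Only terms of a type m X are considered: a cut can reduce to anything.
instance-head : ∀ {ρ Δ o c X} → Δ ⊢ o ∶ m X → NV ρ o → Inst↠ ρ o c → Head ρ o c
instance-head _ nv (_ , ivar p , q) with var↠ (transport (_↠ _) (proj₂ (nv refl)) p)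
... | refl with var↠ q
...   | refl = hvar
instance-head _ _ (_ , ipair i j , q) with pair↠ q
... | _ , _ , refl , q₁ , q₂ = hpair (_ , i , q₁) (_ , j , q₂)
instance-head _ _ (_ , iσ₁ i , q) with σ₁↠ q
... | _ , refl , q' = hσ₁ (_ , i , q')
instance-head _ _ (_ , iσ₂ i , q) with σ₂↠ q
... | _ , refl , q' = hσ₂ (_ , i , q')
instance-head _ _ (_ , ilam i , q) with lam↠ q
... | _ , refl , q' = hlam (_ , i , q')
instance-head () _ (_ , icut _ _ , _)

switch-lift : ∀ {ρ o₁ o₂ c₁ c₂ u v} → Switch c₁ c₂ u v → Head ρ o₁ c₁ → Head ρ o₂ c₂
  → Σ[ o₁' ∈ Term ] Σ[ o₂' ∈ Term ] Switch o₁ o₂ o₁' o₂' × Inst↠ ρ o₁' u × Inst↠ ρ o₂' v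
switch-lift πˡ₁ (hpair h _) (hσ₁ h') = _ , _ , πˡ₁ , h , h'
switch-lift πˡ₂ (hpair _ h) (hσ₂ h') = _ , _ , πˡ₂ , h , h'
switch-lift πʳ₁ (hσ₁ h) (hpair h' _) = _ , _ , πʳ₁ , h , h'
switch-lift πʳ₂ (hσ₂ h) (hpair _ h') = _ , _ , πʳ₂ , h , h'

root-lift : ∀ {ρ Δ o₁ o₂ a₁ a₂ u₁ u₂ c X Y}
  → Δ ⊢ o₁ ∶ m X → Δ ⊢ o₂ ∶ m Y → NV ρ o₁ → NV ρ o₂ → Inst ρ o₁ a₁ → Inst ρ o₂ a₂
  → a₁ ↠ u₁ → a₂ ↠ u₂ → (u₁ ⋆ u₂) ⊳ c
  → Σ[ o ∈ Term ] (o₁ ⋆ o₂) ⟶ o × Inst↠ ρ o c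
root-lift d e nv₁ nv₂ i j q₁ q₂ βˡ with instance-head d nv₁ (_ , i , q₁)
... | hlam (_ , i' , p) = _ , βl , _ , Inst-β i' j , ↠-single p q₂
root-lift d e nv₁ nv₂ i j q₁ q₂ βʳ with instance-head e nv₂ (_ , j , q₂)
... | hlam (_ , j' , p) = _ , βr , _ , Inst-β j' i , ↠-single p q₁
root-lift d e nv₁ nv₂ i j q₁ q₂ (π s)
  with switch-lift s (instance-head d nv₁ (_ , i , q₁)) (instance-head e nv₂ (_ , j , q₂))
... | _ , _ , s' , (_ , i' , p₁) , (_ , j' , p₂) =
  _ , ⊳⇒⟶ (π s') , _ , icut i' j' , ↠-cut p₁ p₂

-- Partners and environments for a fixed type B.  The notions are indexed by an
-- accessibility proof ac of a pattern o (its level).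

module Candidates (B : MType) where

  mutual
    Partner : ∀ {o} → Acc _◁_ o → Ctx → Term → Set
    Partner {o} (acc rs) Γ w = ∀ {y} (r : y ◁ o) → Partner (rs r) Γ w × Clause (rs r) Γ w

    Clause : ∀ {p} → Acc _◁_ p → Ctx → Term → Set
    Clause {p} ac Γ w = ∀ {Δ Γ' ρ a θ} → Δ ⊢ p ∶ m (B ᗮ) → Env ac Δ Γ' ρ → Inst ρ p a
      → TRen θ Γ Γ' → SN (a ⋆ rename θ w)

    Env : ∀ {o} → Acc _◁_ o → Ctx → Ctx → (ℕ → Term) → Set
    Env ac Δ Γ ρ = ∀ {n C} → Δ ∋ n ∶ C → Slot ac Γ C (ρ n)

    Slot : ∀ {o} → Acc _◁_ o → Ctx → MType → Term → Set
    Slot ac Γ C t = (Σ[ x ∈ ℕ ] t ≡ var x × Γ ∋ x ∶ C)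
                  ⊎ (C ≡ B × Γ ⊢ t ∶ m B × SN t × Partner ac Γ t)

  Env-mono : ∀ {o Δ Γ ρ} {rs : WfRec _◁_ (Acc _◁_) o} → Env (acc rs) Δ Γ ρ
    → ∀ {y} (r : y ◁ o) → Env (rs r) Δ Γ ρ
  Env-mono env r x with env x
  ... | inj₁ v                = inj₁ v
  ... | inj₂ (e , d , s , pw) = inj₂ (e , d , s , proj₁ (pw r))

  partner-cut : ∀ {o y Δ Γ ρ a w} {rs : WfRec _◁_ (Acc _◁_) o} → Partner (acc rs) Γ w
    → (r : y ◁ o) → Δ ⊢ y ∶ m (B ᗮ) → Env (rs r) Δ Γ ρ → Inst ρ y a → SN (a ⋆ w)
  partner-cut pw r d env i =
    transport (λ u → SN (_ ⋆ u)) (rename-id _) (proj₂ (pw r) d env i (λ x → x))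

  Clause-rename : ∀ {o} (ac : Acc _◁_ o) {Γ Γ' θ w} → TRen θ Γ Γ' → Clause ac Γ w
    → Clause ac Γ' (rename θ w)
  Clause-rename ac {θ = θ} {w} r c {θ = θ'} d env i r' =
    transport (λ u → SN (_ ⋆ u)) (sym (rename-rename θ' θ w)) (c d env i (r' ∘ r))

  Partner-rename : ∀ {o} (ac : Acc _◁_ o) {Γ Γ' θ w} → TRen θ Γ Γ' → Partner ac Γ w
    → Partner ac Γ' (rename θ w)
  Partner-rename (acc rs) r pw y◁ =
    Partner-rename (rs y◁) r (proj₁ (pw y◁)) , Clause-rename (rs y◁) r (proj₂ (pw y◁))

  Partner-↠ : ∀ {o} (ac : Acc _◁_ o) {Γ w w'} → w ↠ w' → Partner ac Γ w
    → Partner ac Γ w'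
  Partner-↠ (acc rs) q pw y◁ = Partner-↠ (rs y◁) q (proj₁ (pw y◁)) , clause
    where
    clause : Clause (rs y◁) _ _
    clause {θ = θ} d env i r = SN-↠ (proj₂ (pw y◁) d env i r) (↠-cut ε (↠-rename θ q))

  Slot-rename : ∀ {o} {ac : Acc _◁_ o} {Γ Γ' θ C t} → TRen θ Γ Γ' → Slot ac Γ C t
    → Slot ac Γ' C (rename θ t)
  Slot-rename r (inj₁ (x , refl , x∈)) = inj₁ (_ , refl , r x∈)
  Slot-rename {ac = ac} {θ = θ} r (inj₂ (e , d , s , pw)) =
    inj₂ (e , ⊢-rename r d , SN-rename θ s , Partner-rename ac r pw)

  Env-rename : ∀ {o} {ac : Acc _◁_ o} {Δ Γ Γ' θ ρ} → TRen θ Γ Γ' → Env ac Δ Γ ρ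
    → Env ac Δ Γ' (rename θ ∘ ρ)
  Env-rename r env x = Slot-rename r (env x)

  Env-exts : ∀ {o} {ac : Acc _◁_ o} {Δ Γ ρ C} → Env ac Δ Γ ρ
    → Env ac (C ∷ Δ) (C ∷ Γ) (exts ρ)
  Env-exts env here      = inj₁ (0 , refl , here)
  Env-exts env (there x) = Slot-rename there (env x)

  Env-id : ∀ {o} {ac : Acc _◁_ o} {Γ} → Env ac Γ Γ var
  Env-id x = inj₁ (_ , refl , x)

  Env-typed : ∀ {o} {ac : Acc _◁_ o} {Δ Γ ρ} → Env ac Δ Γ ρ → TypedEnv ρ Δ Γ
  Env-typed env x p with env x
  ... | inj₁ (y , e , y∈) with var↠ (transport (_↠ _) e p)
  ...   | refl = ax y∈
  Env-typed env x p | inj₂ (refl , d , _ , _) = subject-reduction* d p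

  Inst-typed : ∀ {o} {ac : Acc _◁_ o} {Δ Γ ρ p a T} → Env ac Δ Γ ρ → Inst ρ p a → Δ ⊢ p ∶ T
    → Γ ⊢ a ∶ T
  Inst-typed env = Inst-⊢ (Env-typed env)

  slot-SN : ∀ {o} {ac : Acc _◁_ o} {Γ C t a} → Slot ac Γ C t → t ↠ a → SN a
  slot-SN (inj₁ (x , refl , _)) p with var↠ p
  ... | refl = SN-var
  slot-SN (inj₂ (_ , _ , s , _)) p = SN-↠ s p

  data Kind {o} (ac : Acc _◁_ o) (Γ : Ctx) (ρ : ℕ → Term) : Term → MType → Set where
    value : ∀ {n X} → X ≡ B → Partner ac Γ (ρ n) → Kind ac Γ ρ (var n) X
    other : ∀ {p X} → NV ρ p → Kind ac Γ ρ p X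

  classify : ∀ {o} {ac : Acc _◁_ o} {Δ Γ ρ p X} → Env ac Δ Γ ρ → Δ ⊢ p ∶ m X
    → Kind ac Γ ρ p X
  classify env (ax x) with env x
  ... | inj₁ (y , e , _)       = other λ { refl → y , e }
  ... | inj₂ (eq , _ , _ , pw) = value eq pw
  classify env (pair _ _) = other λ ()
  classify env (inj₁ _)   = other λ ()
  classify env (inj₂ _)   = other λ ()
  classify env (abs _)    = other λ ()

  instance-SN : ∀ {o} (ac : Acc _◁_ o) {Δ Γ ρ a T} → Δ ⊢ o ∶ T → Env ac Δ Γ ρ → Inst ρ o a
    → SN a
  instance-SN ac (ax x) env (ivar p) = slot-SN (env x) p
  instance-SN (acc rs) (pair d e) env (ipair i j) =
    SN-pair (instance-SN (rs pairˡ) d (Env-mono env pairˡ) i)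
            (instance-SN (rs pairʳ) e (Env-mono env pairʳ) j)
  instance-SN (acc rs) (inj₁ d) env (iσ₁ i) = SN-σ₁ (instance-SN (rs arg₁) d (Env-mono env arg₁) i)
  instance-SN (acc rs) (inj₂ d) env (iσ₂ i) = SN-σ₂ (instance-SN (rs arg₂) d (Env-mono env arg₂) i)
  instance-SN (acc rs) (abs d) env (ilam i) =
    SN-lam (instance-SN (rs body) d (Env-exts (Env-mono env body)) i)
  instance-SN (acc rs) (cut d e) env (icut i j) with classify env d | classify env e
  instance-SN (acc rs) (cut d e) env (icut (ivar p) j) | value eq pw | _ =
    SN-↠ (SN-swap (partner-cut pw cutʳ (castT (ᗮ-swap eq) e) (Env-mono env cutʳ) j)) (↠-cut p ε)
  instance-SN (acc rs) (cut d e) env (icut i (ivar p)) | other _ | value eq pw =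
    SN-↠ (partner-cut pw cutˡ (castT (cong _ᗮ eq) d) (Env-mono env cutˡ) i) (↠-cut ε p)
  instance-SN (acc rs) (cut d e) env (icut {P' = a₁} {Q' = a₂} i j) | other nv₁ | other nv₂ =
    cutSN (instance-SN (rs cutˡ) d (Env-mono env cutˡ) i)
          (instance-SN (rs cutʳ) e (Env-mono env cutʳ) j) root
    where
    -- a root contraction is a reduct of an instance of a reduct of the pattern
    root : ∀ {u₁ u₂ c} → a₁ ↠ u₁ → a₂ ↠ u₂ → (u₁ ⋆ u₂) ⊳ c → SN c
    root q₁ q₂ r with root-lift d e nv₁ nv₂ i j q₁ q₂ r
    ... | _ , r' , _ , i' , q =
      SN-↠ (instance-SN (rs (red r')) (subject-reduction (cut d e) r') (Env-mono env (red r')) i') q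

  -- β-step between an instance of a B^⊥-pattern and a partner: the body is an
  -- instance of the pattern's body, in the environment extended by the partner.
  β-instance : ∀ {o} (ac : Acc _◁_ o) {Δ Γ ρ a b P b'} → Δ ⊢ o ∶ m (B ᗮ) → Env ac Δ Γ ρ
    → Inst ρ o a → Γ ⊢ b ∶ m B → SN b → Partner ac Γ b → a ↠ lam P → b ↠ b' → SN (P [ b' ])
  β-instance ac d env i db sb pb q₁ q₂ with classify env d
  ... | value eq _ = ⊥-elim (ᗮ-irreflexive B (sym eq))
  ... | other nv with instance-head d nv (_ , i , q₁)
  β-instance (acc rs) {ρ = ρ} {b' = b'} d env i db sb pb q₁ q₂
    | other nv | hlam (_ , i' , p) with inv-abs d
  ... | C , eq , dO with ᗮ-injective eq
  ... | refl = SN-↠ (instance-SN (rs body) dO env' (Inst-bind i')) (↠-single p ε)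
    where
    env' : Env (rs body) (B ∷ _) _ (b' ∷ₛ ρ)
    env' here      = inj₂ (refl , subject-reduction* db q₂ , SN-↠ sb q₂ ,
                           Partner-↠ (rs body) q₂ (proj₁ (pb body)))
    env' (there x) = Env-mono env body x

CutSN : MType → Set
CutSN B = ∀ {Γ U V} → Γ ⊢ U ∶ m (B ᗮ) → Γ ⊢ V ∶ m B → SN U → SN V → SN (U ⋆ V)

-- Given CutSN at the components of B, instances of B^⊥- and B-patterns cut
-- against each other are SN, and each is a partner for the other.
module Duality (B : MType) (ih : ∀ {C} → C ≺ B → CutSN C) where

  module L  = Candidates B
  module L' = Candidates (B ᗮ)

  mutual
    cut-instances : ∀ {p q} (acp : Acc _◁_ p) (acq : Acc _◁_ q) {Δ Δ' Γ ρ ρ' a b}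
      → Δ ⊢ p ∶ m (B ᗮ) → Δ' ⊢ q ∶ m ((B ᗮ) ᗮ) → L.Env acp Δ Γ ρ → L'.Env acq Δ' Γ ρ'
      → Inst ρ p a → Inst ρ' q b → SN (a ⋆ b)
    cut-instances acp acq {Γ = Γ} {a = a} {b} d e env env' i j = cutSN sa sb root
      where
      sa : SN a
      sa = L.instance-SN acp d env i
      sb : SN b
      sb = L'.instance-SN acq e env' j
      da : Γ ⊢ a ∶ m (B ᗮ)
      da = L.Inst-typed env i d
      db : Γ ⊢ b ∶ m B
      db = castT (ᗮ-involutive B) (L'.Inst-typed env' j e)
      root : ∀ {a' b' c} → a ↠ a' → b ↠ b' → (a' ⋆ b') ⊳ c → SN c
      root q₁ q₂ βˡ = L.β-instance acp d env i db sb (partner-B acq e env' j acp) q₁ q₂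
      root q₁ q₂ βʳ = L'.β-instance acq e env' j da sa (partner-Bᗮ acp d env i acq) q₂ q₁
      root q₁ q₂ (π s)
        with switch-typing s (subject-reduction* da q₁) (subject-reduction* db q₂)
           | switch-SN s (SN-↠ sa q₁) (SN-↠ sb q₂)
      ... | _ , C≺B , du , dv | su , sv = ih C≺B du dv su sv

    partner-B : ∀ {q} (acq : Acc _◁_ q) {Δ' Γ ρ' b} → Δ' ⊢ q ∶ m ((B ᗮ) ᗮ) → L'.Env acq Δ' Γ ρ'
      → Inst ρ' q b → ∀ {p} (acp : Acc _◁_ p) → L.Partner acp Γ b
    partner-B acq e env' j (acc rs) r = partner-B acq e env' j (rs r) , clause
      where
      clause : L.Clause (rs r) _ _
      clause {θ = θ} d env i θ-ren =
        cut-instances (rs r) acq d e env (L'.Env-rename θ-ren env') i (Inst-rename-values θ j)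

    partner-Bᗮ : ∀ {p} (acp : Acc _◁_ p) {Δ Γ ρ a} → Δ ⊢ p ∶ m (B ᗮ) → L.Env acp Δ Γ ρ
      → Inst ρ p a → ∀ {q} (acq : Acc _◁_ q) → L'.Partner acq Γ a
    partner-Bᗮ acp d env i (acc rs) r = partner-Bᗮ acp d env i (rs r) , clause
      where
      clause : L'.Clause (rs r) _ _
      clause {θ = θ} e env' j θ-ren =
        SN-swap (cut-instances acp (rs r) d e (L.Env-rename θ-ren env) env' (Inst-rename-values θ i) j)

  cut-at : CutSN B
  cut-at dU dV sU sV = cut-instances (SN⇒Acc sU) (SN⇒Acc sV) dU (castT (sym (ᗮ-involutive B)) dV)
    L.Env-id L'.Env-id Inst-id Inst-id

cut-SN : ∀ B → CutSN B
cut-SN (atom a)  = Duality.cut-at (atom a) λ ()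
cut-SN (natom a) = Duality.cut-at (natom a) λ ()
cut-SN (C ∧ D)   = Duality.cut-at (C ∧ D) λ { ∧ˡ → cut-SN C ; ∧ʳ → cut-SN D }
cut-SN (C ∨ D)   = Duality.cut-at (C ∨ D) λ { ∨ˡ → cut-SN C ; ∨ʳ → cut-SN D }

lemma2p11 : (Γ : Ctx) (A : MType) (C : Ty) (M N : Term)
    → (A ∷ Γ) ⊢ M ∶ C → Γ ⊢ N ∶ m A
    → SN M → SN N → SN (M [ N ])
lemma2p11 Γ A C M N dM dN sM sN = L.instance-SN acM dM env (Inst-refl (single N) M)
  where
  module L = Candidates A
  acM : Acc _◁_ M
  acM = SN⇒Acc sM
  N-partner : L.Partner acM Γ N
  N-partner = Duality.partner-B A (λ {E} _ → cut-SN E) (SN⇒Acc sN)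
    (castT (sym (ᗮ-involutive A)) dN) (Candidates.Env-id (A ᗮ)) Inst-id acM
  env : L.Env acM (A ∷ Γ) Γ (single N)
  env here      = inj₂ (refl , dN , sN , N-partner)
  env (there x) = inj₁ (_ , refl , x)
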